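{- Let $\lambda$ be a triangular partition. Then for every $0\le k\le|\lambda|$ there exists a unique subpartition $\mu\subseteq\lambda$ such that $(\lambda,\mu)$ is mean-similar and $\mathrm{area}(\lambda,\mu)=k$. Moreover, if $(\lambda,\alpha)$ and $(\lambda,\mu)$ are both mean-similar with $|\alpha|\le|\mu|$, then $\alpha\subseteq\mu$.
   Context: Partitions are drawn in French convention: cell $(\ell,c)$ ($\ell\ge0$ row from bottom, $c\ge0$ column) belongs to $\lambda$ iff $c<\lambda_{\ell+1}$. A partition is triangular if there exist positive reals $r,s$ with $\lambda_j=\lfloor r-jr/s\rfloor$ for integers $1\le j\le s$ and $\lambda_j=0$ for $j>s$. For a cell $c$ of a partition $\mu$, arm $a(c)$ (resp. leg $\ell(c)$) is the number of cells of $\mu$ strictly to its right in its row (resp. strictly above it in its column); $v^-(c,\mu)=\ell(c)/(a(c)+\ell(c)+1)$, $v^+(c,\mu)=(\ell(c)+1)/(a(c)+\ell(c)+1)$; $v^-_\lambda=\max_{c\in\lambda}v^-(c,\lambda)$, $v^+_\lambda=\min_{c\in\lambda}v^+(c,\lambda)$. For a subpartition $\mu\subseteq\lambda$ ($\mu_i\le\lambda_i$ for all $i$), $\mathrm{area}(\lambda,\mu)=|\lambda|-|\mu|$; a cell $c$ of $\mu$ is similar if $v^-(c,\mu)<\frac{v^-_\lambda+v^+_\lambda}{2}\le v^+(c,\mu)$; $(\lambda,\mu)$ is mean-similar if every cell of $\mu$ is similar.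
   Formalization: The parameters $r,s$ in the definition of a triangular partition range over the positive rationals instead of the positive reals. -}

module Defs where

open import Data.Nat as ℕ using (ℕ; zero; suc; _∸_; _≤_; _<_; _<?_)
open import Data.Integer as ℤ using (ℤ; +_)
open import Data.Rational as ℚ using (ℚ; floor; Positive; _÷_; _≤ᵇ_)
  renaming (_≤_ to _≤ℚ_; _<_ to _<ℚ_)
open import Data.Rational.Properties using (pos⇒nonZero)
open import Data.List using (List; []; _∷_; length; filter; drop; map; concat; upTo; foldr)
open import Data.Nat.ListAction using (sum)
open import Data.List.Relation.Unary.All using (All)
open import Data.Product using (Σ; _×_; _,_; ∃)
open import Relation.Binary.PropositionalEquality using (_≡_)
open import Data.Bool using (if_then_else_)

-- A partition is a list of its (positive) parts, λ = (λ₁ ≥ λ₂ ≥ … ≥ λₙ > 0).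
-- row p ℓ = λ_{ℓ+1} (0 beyond the length), i.e. the length of row ℓ (French convention, ℓ ≥ 0 from the bottom).
row : List ℕ → ℕ → ℕ
row []       _       = 0
row (x ∷ _)  zero    = x
row (_ ∷ xs) (suc ℓ) = row xs ℓ

IsPartition : List ℕ → Set
IsPartition p = (∀ i → row p (suc i) ≤ row p i) × All (λ x → 0 < x) p

size : List ℕ → ℕ
size = sum

_⊆ₚ_ : List ℕ → List ℕ → Set
μ ⊆ₚ la = ∀ i → row μ i ≤ row la i

area : List ℕ → List ℕ → ℕ
area la μ = size la ∸ size μ

nℚ : ℕ → ℚ
nℚ n = (+ n) ℚ./ 1

triVal : (r s : ℚ) → Positive s → ℕ → ℚ
triVal r s ps j = r ℚ.- (_÷_ (nℚ j ℚ.* r) s {{pos⇒nonZero s {{ps}}}})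

Triangular : List ℕ → Set
Triangular la = Σ ℚ λ r → Σ ℚ λ s → Σ (Positive r) λ _ → Σ (Positive s) λ ps →
  ∀ (j : ℕ) → 1 ≤ j →
    (nℚ j ≤ℚ s → + row la (j ∸ 1) ≡ floor (triVal r s ps j))
    × (s <ℚ nℚ j → row la (j ∸ 1) ≡ 0)

-- cell (ℓ, c) ∈ μ  iff  c < row μ ℓ
-- arm: cells strictly to the right in row ℓ
arm : List ℕ → ℕ → ℕ → ℕ
arm μ ℓ c = row μ ℓ ∸ suc c

leg : List ℕ → ℕ → ℕ → ℕ
leg μ ℓ c = length (filter (c <?_) (drop (suc ℓ) μ))

vminus : List ℕ → ℕ → ℕ → ℚ
vminus μ ℓ c = (+ leg μ ℓ c) ℚ./ suc (arm μ ℓ c ℕ.+ leg μ ℓ c)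

vplus : List ℕ → ℕ → ℕ → ℚ
vplus μ ℓ c = (+ suc (leg μ ℓ c)) ℚ./ suc (arm μ ℓ c ℕ.+ leg μ ℓ c)

cellsFrom : ℕ → List ℕ → List (ℕ × ℕ)
cellsFrom ℓ []       = []
cellsFrom ℓ (x ∷ xs) = map (λ c → ℓ , c) (upTo x) Data.List.++ cellsFrom (suc ℓ) xs

cells : List ℕ → List (ℕ × ℕ)
cells = cellsFrom 0

maxℚ minℚ : ℚ → ℚ → ℚ
maxℚ p q = if p ≤ᵇ q then q else p
minℚ p q = if p ≤ᵇ q then p else q

-- v⁻_λ = max over cells of v⁻ (the default 0 is a lower bound of all v⁻ values, so it is harmless)
vminusMax : List ℕ → ℚ
vminusMax la = foldr (λ { (ℓ , c) m → maxℚ (vminus la ℓ c) m }) ℚ.0ℚ (cells la)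

-- v⁺_λ = min over cells of v⁺ (the default 1 is an upper bound of all v⁺ values, so it is harmless)
vplusMin : List ℕ → ℚ
vplusMin la = foldr (λ { (ℓ , c) m → minℚ (vplus la ℓ c) m }) ℚ.1ℚ (cells la)

meanSlope : List ℕ → ℚ
meanSlope la = ((vminusMax la ℚ.+ vplusMin la) ÷ nℚ 2)

Similar : List ℕ → List ℕ → ℕ → ℕ → Set
Similar la μ ℓ c = (vminus μ ℓ c <ℚ meanSlope la) × (meanSlope la ≤ℚ vplus μ ℓ c)

MeanSimilar : List ℕ → List ℕ → Set
MeanSimilar la μ = ∀ ℓ c → c < row μ ℓ → Similar la μ ℓ c

module Submission where

-- Write A = v⁻_λ and B = v⁺_λ. Because λ_{ℓ+1} = ⌊r − (ℓ+1)r/s⌋, every cell of λ with arm a and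
-- leg l satisfies a < (l+1)·r/s and l·r/s < a+1, and these two bounds force v⁻(x) < v⁺(y) for any
-- two cells x, y of λ. Hence A < B, λ itself is mean-similar, and the mean slope is a fraction
-- p/(p+d) with p, d > 0. Clearing denominators, a cell is similar iff d·l < p·(a+1) and p·a ≤ d·(l+1),
-- and a partition all of whose cells satisfy this is exactly an initial segment of the strict total
-- order on cells comparing d·row + p·column (ties: larger column first). Initial segments of a total
-- order are nested and determined by their size, and deleting the largest cell of one leaves another;
-- starting from λ this produces one of every area.

open import Defs
open import Data.Bool using (true; false)
open import Data.Integer as ℤ using (+_; -[1+_])
open import Data.Integer.DivMod using ([n/d]*d≤n; n<s[n/ℕd]*d; div-pos-is-/ℕ)
import Data.Integer.Properties as ℤₚ
open import Data.List using (List; []; _∷_; length; filter; drop; foldr)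
open import Data.List.Membership.Propositional using (_∈_)
open import Data.List.Membership.Propositional.Properties using (∈-++⁺ˡ; ∈-++⁺ʳ; ∈-map⁺; ∈-upTo⁺)
open import Data.List.Properties using (filter-accept; filter-reject)
open import Data.List.Relation.Unary.All using (All; []; _∷_)
import Data.List.Relation.Unary.All as All
import Data.List.Relation.Unary.All.Properties as Allₚ
open import Data.List.Relation.Unary.Any using (here; there)
open import Data.Nat using (ℕ; zero; suc; pred; NonZero; >-nonZero; _+_; _*_; _∸_; _≤_; _<_; _≤?_; _<?_;
  z≤n; s≤s; s≤s⁻¹; z<s)
open import Data.Nat.Coprimality using (1-coprimeTo) renaming (sym to Coprime-sym)
open import Data.Nat.Properties
open import Algebra.Properties.CommutativeSemigroup +-commutativeSemigroup using (xy∙z≈xz∙y)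
open import Data.Nat.Tactic.RingSolver using (solve-∀)
open import Data.Product using (Σ; Σ-syntax; _×_; _,_; proj₁; proj₂)
open import Data.Rational as ℚ using (ℚ; mkℚ; _/_; 0ℚ; 1ℚ)
import Data.Rational.Properties as ℚₚ
open import Data.Rational.Solver using () renaming (module +-*-Solver to ℚSolver)
open import Data.Rational.Unnormalised as ℚᵘ using (mkℚᵘ; *<*; *≤*)
import Data.Rational.Unnormalised.Properties as ℚᵘₚ
open import Data.Sum using (_⊎_; inj₁; inj₂)
open import Function using (_∘_; id)
open import Relation.Binary.Definitions using (tri<; tri≈; tri>)
open import Relation.Binary.PropositionalEquality
open import Relation.Nullary using (¬_; yes; no; contradiction)

-- Partitions

Decreasing : List ℕ → Set
Decreasing xs = ∀ i → row xs (suc i) ≤ row xs i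

PositiveParts : List ℕ → Set
PositiveParts = All (0 <_)

row-antitone : ∀ xs → Decreasing xs → ∀ {i j} → i ≤ j → row xs j ≤ row xs i
row-antitone xs dec {j = zero}  z≤n  = ≤-refl
row-antitone xs dec {j = suc j} i≤1+j with m≤n⇒m<n∨m≡n i≤1+j
... | inj₁ i<1+j = ≤-trans (dec j) (row-antitone xs dec (s≤s⁻¹ i<1+j))
... | inj₂ refl  = ≤-refl

row-drop : ∀ k xs i → row (drop k xs) i ≡ row xs (k + i)
row-drop zero    xs       i = refl
row-drop (suc k) []       i = refl
row-drop (suc k) (x ∷ xs) i = row-drop k xs i

drop-decreasing : ∀ k xs → Decreasing xs → Decreasing (drop k xs)
drop-decreasing k xs dec i rewrite row-drop k xs (suc i) | row-drop k xs i | +-suc k i = dec (k + i)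

<length-filter⇒<row : ∀ {c} xs {i} → Decreasing xs → i < length (filter (c <?_) xs) → c < row xs i
<length-filter⇒<row {c} (x ∷ xs) {i} dec i<n with c <? x
... | yes c<x = accepted i (subst (i <_) (cong length (filter-accept (c <?_) c<x)) i<n)
  where
  accepted : ∀ i → i < suc (length (filter (c <?_) xs)) → c < row (x ∷ xs) i
  accepted zero    _   = c<x
  accepted (suc i) i<n = <length-filter⇒<row xs (dec ∘ suc) (s≤s⁻¹ i<n)
... | no c≮x = contradiction
  (≤-trans (<length-filter⇒<row xs (dec ∘ suc) i<n′) (row-antitone (x ∷ xs) dec {j = suc i} z≤n)) c≮x
  where i<n′ = subst (i <_) (cong length (filter-reject (c <?_) c≮x)) i<n

<row⇒<length-filter : ∀ {c} xs {i} → Decreasing xs → c < row xs i → i < length (filter (c <?_) xs)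
<row⇒<length-filter {c} (x ∷ xs) {i} dec c<xᵢ with c <? x
... | yes c<x rewrite filter-accept (c <?_) {x} {xs} c<x = accepted i c<xᵢ
  where
  accepted : ∀ i → c < row (x ∷ xs) i → i < suc (length (filter (c <?_) xs))
  accepted zero    _     = s≤s z≤n
  accepted (suc i) c<xᵢ = s≤s (<row⇒<length-filter xs (dec ∘ suc) c<xᵢ)
... | no c≮x = contradiction (<-≤-trans c<xᵢ (row-antitone (x ∷ xs) dec {j = i} z≤n)) c≮x

row-arm : ∀ μ {ℓ c} → c < row μ ℓ → row μ ℓ ≡ c + suc (arm μ ℓ c)
row-arm μ {ℓ} {c} c<μℓ = trans (sym (m+[n∸m]≡n c<μℓ)) (sym (+-suc c (arm μ ℓ c)))

leg-top : ∀ {μ} → IsPartition μ → ∀ {ℓ c} → c < row μ ℓ → c < row μ (ℓ + leg μ ℓ c)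
leg-top {μ} (dec , _) {ℓ} {c} c<μℓ with leg μ ℓ c in eq
... | zero  = subst (λ i → c < row μ i) (sym (+-identityʳ ℓ)) c<μℓ
... | suc l = subst (c <_) (trans (row-drop (suc ℓ) μ l) (cong (row μ) (sym (+-suc ℓ l))))
  (<length-filter⇒<row (drop (suc ℓ) μ) (drop-decreasing (suc ℓ) μ dec) (subst (l <_) (sym eq) ≤-refl))

leg-out : ∀ {μ} → IsPartition μ → ∀ {ℓ c} → ¬ c < row μ (ℓ + suc (leg μ ℓ c))
leg-out {μ} (dec , _) {ℓ} {c} c<μ = n≮n (leg μ ℓ c)
  (<row⇒<length-filter (drop (suc ℓ) μ) (drop-decreasing (suc ℓ) μ dec)
    (subst (c <_) (trans (cong (row μ) (+-suc ℓ (leg μ ℓ c))) (sym (row-drop (suc ℓ) μ (leg μ ℓ c)))) c<μ))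

row>0⇒<length : ∀ xs {i} → 0 < row xs i → i < length xs
row>0⇒<length (x ∷ xs) {zero}  _      = z<s
row>0⇒<length (x ∷ xs) {suc i} xsᵢ>0 = s≤s (row>0⇒<length xs xsᵢ>0)

<length⇒row>0 : ∀ {xs i} → PositiveParts xs → i < length xs → 0 < row xs i
<length⇒row>0 {i = zero}  (x>0 ∷ _)   _       = x>0
<length⇒row>0 {i = suc i} (_ ∷ xs>0) (s≤s i<n) = <length⇒row>0 xs>0 i<n

row≤size : ∀ xs i → row xs i ≤ size xs
row≤size []       i       = z≤n
row≤size (x ∷ xs) zero    = m≤m+n x (size xs)
row≤size (x ∷ xs) (suc i) = ≤-trans (row≤size xs i) (m≤n+m (size xs) x)

size-mono : ∀ μ α → μ ⊆ₚ α → size μ ≤ size α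
size-mono []      α       μ⊆α = z≤n
size-mono (y ∷ μ) []      μ⊆α = +-mono-≤ (μ⊆α 0) (size-mono μ [] (μ⊆α ∘ suc))
size-mono (y ∷ μ) (x ∷ α) μ⊆α = +-mono-≤ (μ⊆α 0) (size-mono μ α (μ⊆α ∘ suc))

size-mono-< : ∀ μ α → μ ⊆ₚ α → ∀ j → row μ j < row α j → size μ < size α
size-mono-< μ       []      μ⊆α j       ()
size-mono-< []      α       μ⊆α j       μⱼ<αⱼ = <-≤-trans μⱼ<αⱼ (row≤size α j)
size-mono-< (y ∷ μ) (x ∷ α) μ⊆α zero    y<x   = +-mono-<-≤ y<x (size-mono μ α (μ⊆α ∘ suc))
size-mono-< (y ∷ μ) (x ∷ α) μ⊆α (suc j) μⱼ<αⱼ = +-mono-≤-< (μ⊆α 0) (size-mono-< μ α (μ⊆α ∘ suc) j μⱼ<αⱼ)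

+≡⇒area≡ : ∀ la μ {k} → size μ + k ≡ size la → area la μ ≡ k
+≡⇒area≡ la μ {k} |μ|+k≡|la| = trans (cong (_∸ size μ) (sym |μ|+k≡|la|)) (m+n∸m≡n (size μ) k)

area≡⇒+≡ : ∀ la μ {k} → μ ⊆ₚ la → area la μ ≡ k → size μ + k ≡ size la
area≡⇒+≡ la μ μ⊆la area≡k = trans (cong (_+_ (size μ)) (sym area≡k)) (m+[n∸m]≡n (size-mono μ la μ⊆la))

row-injective : ∀ {xs ys} → PositiveParts xs → PositiveParts ys → (∀ i → row xs i ≡ row ys i) → xs ≡ ys
row-injective {[]}     {[]}     _          _          _  = refl
row-injective {[]}     {y ∷ ys} _          (y>0 ∷ _)  eq = contradiction (eq 0) (<⇒≢ y>0)
row-injective {x ∷ xs} {[]}     (x>0 ∷ _)  _          eq = contradiction (eq 0) (>⇒≢ x>0)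
row-injective {x ∷ xs} {y ∷ ys} (_ ∷ xs>0) (_ ∷ ys>0) eq =
  cong₂ _∷_ (eq 0) (row-injective xs>0 ys>0 (eq ∘ suc))

cellsFrom-below : ∀ (R : ℕ → ℕ) ℓ₀ μ → (∀ i → row μ i ≡ R (ℓ₀ + i)) →
                  All (λ x → proj₂ x < R (proj₁ x)) (cellsFrom ℓ₀ μ)
cellsFrom-below R ℓ₀ []      _    = []
cellsFrom-below R ℓ₀ (x ∷ μ) μ≡R = Allₚ.++⁺
  (Allₚ.map⁺ (Allₚ.applyUpTo⁺₁ id x (subst (_ <_) (trans (μ≡R 0) (cong R (+-identityʳ ℓ₀))))))
  (cellsFrom-below R (suc ℓ₀) μ (λ i → trans (μ≡R (suc i)) (cong R (+-suc ℓ₀ i))))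

cells-below : ∀ μ → All (λ x → proj₂ x < row μ (proj₁ x)) (cells μ)
cells-below μ = cellsFrom-below (row μ) 0 μ (λ _ → refl)

∈-cellsFrom : ∀ ℓ₀ μ {ℓ c} → c < row μ ℓ → (ℓ₀ + ℓ , c) ∈ cellsFrom ℓ₀ μ
∈-cellsFrom ℓ₀ (x ∷ μ) {zero} {c} c<x rewrite +-identityʳ ℓ₀ = ∈-++⁺ˡ (∈-map⁺ (ℓ₀ ,_) (∈-upTo⁺ c<x))
∈-cellsFrom ℓ₀ (x ∷ μ) {suc ℓ} c<μℓ rewrite +-suc ℓ₀ ℓ = ∈-++⁺ʳ _ (∈-cellsFrom (suc ℓ₀) μ c<μℓ)

∈-cells : ∀ μ {ℓ c} → c < row μ ℓ → (ℓ , c) ∈ cells μ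
∈-cells μ = ∈-cellsFrom 0 μ

-- Deleting a corner cell

removeLast : List ℕ → ℕ → List ℕ
removeLast []                 _       = []
removeLast (x ∷ xs)           (suc k) = x ∷ removeLast xs k
removeLast (suc (suc n) ∷ xs) zero    = suc n ∷ xs
removeLast (_ ∷ xs)           zero    = xs

Corner : List ℕ → ℕ → Set
Corner μ k = row μ (suc k) < row μ k

row₀<1⇒≡[] : ∀ {xs} → PositiveParts xs → row xs 0 < 1 → xs ≡ []
row₀<1⇒≡[] []        _   = refl
row₀<1⇒≡[] (x>0 ∷ _) x<1 = contradiction (n<1⇒n≡0 x<1) (>⇒≢ x>0)

row-removeLast-≡ : ∀ μ k → PositiveParts μ → Corner μ k → row (removeLast μ k) k ≡ pred (row μ k)
row-removeLast-≡ []                k       _         _ = refl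
row-removeLast-≡ (x ∷ μ)           (suc k) (_ ∷ μ>0) c = row-removeLast-≡ μ k μ>0 c
row-removeLast-≡ (suc zero ∷ μ)    zero    (_ ∷ μ>0) c rewrite row₀<1⇒≡[] μ>0 c = refl
row-removeLast-≡ (suc (suc n) ∷ μ) zero    _         _ = refl

row-removeLast-≢ : ∀ μ k → PositiveParts μ → Corner μ k → ∀ {i} → i ≢ k → row (removeLast μ k) i ≡ row μ i
row-removeLast-≢ []                k       _         _ _ = refl
row-removeLast-≢ (x ∷ μ)           (suc k) _         _ {zero}  _   = refl
row-removeLast-≢ (x ∷ μ)           (suc k) (_ ∷ μ>0) c {suc i} i≢k = row-removeLast-≢ μ k μ>0 c (i≢k ∘ cong suc)
row-removeLast-≢ (suc zero ∷ μ)    zero    _         _ {zero}  i≢k = contradiction refl i≢k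
row-removeLast-≢ (suc zero ∷ μ)    zero    (_ ∷ μ>0) c {suc i} _   rewrite row₀<1⇒≡[] μ>0 c = refl
row-removeLast-≢ (suc (suc n) ∷ μ) zero    _         _ {zero}  i≢k = contradiction refl i≢k
row-removeLast-≢ (suc (suc n) ∷ μ) zero    _         _ {suc i} _   = refl

size-removeLast : ∀ μ k → 0 < row μ k → suc (size (removeLast μ k)) ≡ size μ
size-removeLast (x ∷ μ)           (suc k) μₖ>0 = trans (sym (+-suc x _)) (cong (_+_ x) (size-removeLast μ k μₖ>0))
size-removeLast (suc zero ∷ μ)    zero    _    = refl
size-removeLast (suc (suc n) ∷ μ) zero    _    = refl

removeLast-positive : ∀ μ k → PositiveParts μ → PositiveParts (removeLast μ k)
removeLast-positive []                k       _           = []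
removeLast-positive (x ∷ μ)           (suc k) (x>0 ∷ μ>0) = x>0 ∷ removeLast-positive μ k μ>0
removeLast-positive (zero ∷ μ)        zero    (_ ∷ μ>0)   = μ>0
removeLast-positive (suc zero ∷ μ)    zero    (_ ∷ μ>0)   = μ>0
removeLast-positive (suc (suc n) ∷ μ) zero    (_ ∷ μ>0)   = z<s ∷ μ>0

module _ {μ k} (P : IsPartition μ) (corner : Corner μ k) where

  private
    μ>0 = proj₂ P
    row-k = row-removeLast-≡ μ k μ>0 corner
    row-≢ = row-removeLast-≢ μ k μ>0 corner

  removeLast-⊆ : removeLast μ k ⊆ₚ μ
  removeLast-⊆ i with i ≟ k
  ... | yes refl = ≤-trans (≤-reflexive row-k) pred[n]≤n
  ... | no  i≢k  = ≤-reflexive (row-≢ i≢k)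

  removeLast-removed : ∀ {ℓ c} → c < row μ ℓ → ¬ c < row (removeLast μ k) ℓ → ℓ ≡ k × c ≡ pred (row μ k)
  removeLast-removed {ℓ} {c} c<μℓ c≮μ′ℓ with ℓ ≟ k
  ... | yes refl = refl , ≤-antisym (<⇒≤pred c<μℓ) (≮⇒≥ (c≮μ′ℓ ∘ subst (c <_) (sym row-k)))
  ... | no  ℓ≢k  = contradiction (subst (c <_) (sym (row-≢ ℓ≢k)) c<μℓ) c≮μ′ℓ

  removeLast-isPartition : IsPartition (removeLast μ k)
  removeLast-isPartition = decreasing , removeLast-positive μ k μ>0
    where
    open ≤-Reasoning
    decreasing : Decreasing (removeLast μ k)
    decreasing i with i ≟ k | suc i ≟ k
    ... | yes refl | _ = begin
      row (removeLast μ i) (suc i) ≡⟨ row-≢ 1+n≢n ⟩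
      row μ (suc i)                ≤⟨ <⇒≤pred corner ⟩
      pred (row μ i)               ≡⟨ row-k ⟨
      row (removeLast μ i) i       ∎
    ... | no i≢k | yes refl = begin
      row (removeLast μ (suc i)) (suc i) ≡⟨ row-k ⟩
      pred (row μ (suc i))               ≤⟨ pred[n]≤n ⟩
      row μ (suc i)                      ≤⟨ proj₁ P i ⟩
      row μ i                            ≡⟨ row-≢ i≢k ⟨
      row (removeLast μ (suc i)) i       ∎
    ... | no i≢k | no 1+i≢k = begin
      row (removeLast μ k) (suc i) ≡⟨ row-≢ 1+i≢k ⟩
      row μ (suc i)                ≤⟨ proj₁ P i ⟩
      row μ i                      ≡⟨ row-≢ i≢k ⟨
      row (removeLast μ k) i       ∎

-- Initial segments of a slope order

-- Similarity of every cell for the slope p / (p + d), with denominators cleared.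
Balanced : ℕ → ℕ → List ℕ → Set
Balanced p d μ = ∀ ℓ c → c < row μ ℓ →
  d * leg μ ℓ c < p * suc (arm μ ℓ c) × p * arm μ ℓ c ≤ d * suc (leg μ ℓ c)

module SlopeOrder (p d : ℕ) .{{_ : NonZero p}} .{{_ : NonZero d}} where

  weight : ℕ × ℕ → ℕ
  weight (ℓ , c) = d * ℓ + p * c

  infix 4 _≺_
  _≺_ : ℕ × ℕ → ℕ × ℕ → Set
  x ≺ y = weight x < weight y ⊎ (weight x ≡ weight y × proj₂ y < proj₂ x)

  weight-mono-≤ : ∀ {ℓ ℓ′ c c′} → ℓ ≤ ℓ′ → c ≤ c′ → weight (ℓ , c) ≤ weight (ℓ′ , c′)
  weight-mono-≤ ℓ≤ℓ′ c≤c′ = +-mono-≤ (*-monoʳ-≤ d ℓ≤ℓ′) (*-monoʳ-≤ p c≤c′)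

  weight-mono-<-≤ : ∀ {ℓ ℓ′ c c′} → ℓ < ℓ′ → c ≤ c′ → weight (ℓ , c) < weight (ℓ′ , c′)
  weight-mono-<-≤ ℓ<ℓ′ c≤c′ = +-mono-<-≤ (*-monoʳ-< d ℓ<ℓ′) (*-monoʳ-≤ p c≤c′)

  weight-mono-≤-< : ∀ {ℓ ℓ′ c c′} → ℓ ≤ ℓ′ → c < c′ → weight (ℓ , c) < weight (ℓ′ , c′)
  weight-mono-≤-< ℓ≤ℓ′ c<c′ = +-mono-≤-< (*-monoʳ-≤ d ℓ≤ℓ′) (*-monoʳ-< p c<c′)

  weight-+ˡ : ∀ ℓ l c → weight (ℓ + l , c) ≡ weight (ℓ , c) + d * l
  weight-+ˡ ℓ l c = trans (cong (_+ p * c) (*-distribˡ-+ d ℓ l)) (xy∙z≈xz∙y (d * ℓ) (d * l) (p * c))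

  weight-+ʳ : ∀ ℓ c a → weight (ℓ , c + a) ≡ weight (ℓ , c) + p * a
  weight-+ʳ ℓ c a = trans (cong (_+_ (d * ℓ)) (*-distribˡ-+ p c a)) (sym (+-assoc (d * ℓ) (p * c) (p * a)))

  ≺-asym : ∀ {x y} → x ≺ y → ¬ y ≺ x
  ≺-asym (inj₁ x<y)       (inj₁ y<x)       = <-asym x<y y<x
  ≺-asym (inj₁ x<y)       (inj₂ (y≡x , _)) = <⇒≢ x<y (sym y≡x)
  ≺-asym (inj₂ (x≡y , _)) (inj₁ y<x)       = <⇒≢ y<x (sym x≡y)
  ≺-asym (inj₂ (_ , y<x)) (inj₂ (_ , x<y)) = <-asym x<y y<x

  ≺-trans : ∀ {x y z} → x ≺ y → y ≺ z → x ≺ z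
  ≺-trans (inj₁ x<y)        (inj₁ y<z)        = inj₁ (<-trans x<y y<z)
  ≺-trans (inj₁ x<y)        (inj₂ (y≡z , _))  = inj₁ (<-≤-trans x<y (≤-reflexive y≡z))
  ≺-trans (inj₂ (x≡y , _))  (inj₁ y<z)        = inj₁ (≤-<-trans (≤-reflexive x≡y) y<z)
  ≺-trans (inj₂ (x≡y , y<x)) (inj₂ (y≡z , z<y)) = inj₂ (trans x≡y y≡z , <-trans z<y y<x)

  ≺-total : ∀ {x y} → proj₁ x ≢ proj₁ y → x ≺ y ⊎ y ≺ x
  ≺-total {ℓ , c} {ℓ′ , c′} ℓ≢ℓ′ with <-cmp (weight (ℓ , c)) (weight (ℓ′ , c′)) | <-cmp c c′
  ... | tri< x<y _ _ | _            = inj₁ (inj₁ x<y)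
  ... | tri> _ _ y<x | _            = inj₂ (inj₁ y<x)
  ... | tri≈ _ x≡y _ | tri< c<c′ _ _ = inj₂ (inj₂ (sym x≡y , c<c′))
  ... | tri≈ _ x≡y _ | tri> _ _ c′<c = inj₁ (inj₂ (x≡y , c′<c))
  ... | tri≈ _ x≡y _ | tri≈ _ refl _ = contradiction (*-cancelˡ-≡ ℓ ℓ′ d (+-cancelʳ-≡ (p * c) _ _ x≡y)) ℓ≢ℓ′

  ≺⇒weight≤ : ∀ {x y} → x ≺ y → weight x ≤ weight y
  ≺⇒weight≤ (inj₁ x<y)       = <⇒≤ x<y
  ≺⇒weight≤ (inj₂ (x≡y , _)) = ≤-reflexive x≡y

  ≺⇒weight< : ∀ {x y} → x ≺ y → proj₂ x ≤ proj₂ y → weight x < weight y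
  ≺⇒weight< (inj₁ x<y)       _      = x<y
  ≺⇒weight< (inj₂ (_ , y<x)) x≤y   = contradiction x≤y (<⇒≱ y<x)

  weight≤⇒≺ : ∀ {x y} → weight x ≤ weight y → proj₂ y < proj₂ x → x ≺ y
  weight≤⇒≺ x≤y c′<c with m≤n⇒m<n∨m≡n x≤y
  ... | inj₁ x<y = inj₁ x<y
  ... | inj₂ x≡y = inj₂ (x≡y , c′<c)

  ≺-leftward : ∀ {ℓ c c′ y} → c ≤ c′ → (ℓ , c′) ≺ y → (ℓ , c) ≺ y
  ≺-leftward c≤c′ x′≺y with m≤n⇒m<n∨m≡n c≤c′
  ... | inj₁ c<c′ = inj₁ (<-≤-trans (weight-mono-≤-< ≤-refl c<c′) (≺⇒weight≤ x′≺y))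
  ... | inj₂ refl = x′≺y

  Initial : List ℕ → Set
  Initial μ = ∀ {ℓ c ℓ′ c′} → c < row μ ℓ → ¬ c′ < row μ ℓ′ → (ℓ , c) ≺ (ℓ′ , c′)

  module _ {μ} (P : IsPartition μ) where

    private
      antitone = row-antitone μ (proj₁ P)

    initial⇒balanced : Initial μ → Balanced p d μ
    initial⇒balanced I ℓ c c<μℓ = leg-bound , arm-bound
      where
      a = arm μ ℓ c
      l = leg μ ℓ c
      row-end : row μ ℓ ≡ c + suc a
      row-end = row-arm μ c<μℓ
      leg-bound : d * l < p * suc a
      leg-bound = +-cancelˡ-< (weight (ℓ , c)) _ _
        (subst₂ _<_ (weight-+ˡ ℓ l c) (weight-+ʳ ℓ c (suc a))
          (≺⇒weight< (I (leg-top P c<μℓ) (n≮n _ ∘ subst (c + suc a <_) row-end)) (m≤m+n c (suc a))))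
      arm-bound : p * a ≤ d * suc l
      arm-bound = +-cancelˡ-≤ (weight (ℓ , c)) _ _
        (subst₂ _≤_ (weight-+ʳ ℓ c a) (weight-+ˡ ℓ (suc l) c)
          (≺⇒weight≤ (I (subst (c + a <_) (sym row-end) (+-monoʳ-< c ≤-refl)) (leg-out P))))

    module _ (B : Balanced p d μ) where

      outside-below-heavier : ∀ {ℓ c ℓ′ c′} → c < row μ ℓ → ¬ c′ < row μ ℓ′ → ℓ′ ≤ ℓ →
                              weight (ℓ , c) < weight (ℓ′ , c′)
      outside-below-heavier {ℓ} {c} {ℓ′} {c′} c<μℓ c′≮μℓ′ ℓ′≤ℓ = begin-strict
        weight (ℓ , c)              ≤⟨ weight-mono-≤ ℓ≤ℓ′+l ≤-refl ⟩
        weight (ℓ′ + l , c)         ≡⟨ weight-+ˡ ℓ′ l c ⟩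
        weight (ℓ′ , c) + d * l     <⟨ +-monoʳ-< (weight (ℓ′ , c)) (proj₁ (B ℓ′ c c<μℓ′)) ⟩
        weight (ℓ′ , c) + p * suc a ≡⟨ weight-+ʳ ℓ′ c (suc a) ⟨
        weight (ℓ′ , c + suc a)     ≤⟨ weight-mono-≤ ≤-refl c+1+a≤c′ ⟩
        weight (ℓ′ , c′)            ∎
        where
        open ≤-Reasoning
        c<μℓ′ = <-≤-trans c<μℓ (antitone ℓ′≤ℓ)
        a = arm μ ℓ′ c
        l = leg μ ℓ′ c
        ℓ≤ℓ′+l : ℓ ≤ ℓ′ + l
        ℓ≤ℓ′+l = ≮⇒≥ (λ ℓ′+l<ℓ → leg-out P (<-≤-trans c<μℓ (antitone (subst (_≤ ℓ) (sym (+-suc ℓ′ l)) ℓ′+l<ℓ))))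
        c+1+a≤c′ : c + suc a ≤ c′
        c+1+a≤c′ = subst (_≤ c′) (row-arm μ c<μℓ′) (≮⇒≥ c′≮μℓ′)

      outside-left-not-lighter : ∀ {ℓ c ℓ′ c′} → c < row μ ℓ → ¬ c′ < row μ ℓ′ → c′ ≤ c →
                                 weight (ℓ , c) ≤ weight (ℓ′ , c′)
      outside-left-not-lighter {ℓ} {c} {ℓ′} {c′} c<μℓ c′≮μℓ′ c′≤c = begin
        weight (ℓ , c)                ≤⟨ weight-mono-≤ ≤-refl c≤c′+a ⟩
        weight (ℓ , c′ + a)           ≡⟨ weight-+ʳ ℓ c′ a ⟩
        weight (ℓ , c′) + p * a       ≤⟨ +-monoʳ-≤ (weight (ℓ , c′)) (proj₂ (B ℓ c′ c′<μℓ)) ⟩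
        weight (ℓ , c′) + d * suc l   ≡⟨ weight-+ˡ ℓ (suc l) c′ ⟨
        weight (ℓ + suc l , c′)       ≤⟨ weight-mono-≤ ℓ+1+l≤ℓ′ ≤-refl ⟩
        weight (ℓ′ , c′)              ∎
        where
        open ≤-Reasoning
        c′<μℓ = ≤-<-trans c′≤c c<μℓ
        a = arm μ ℓ c′
        l = leg μ ℓ c′
        c≤c′+a : c ≤ c′ + a
        c≤c′+a = s≤s⁻¹ (subst (c <_) (trans (row-arm μ c′<μℓ) (+-suc c′ a)) c<μℓ)
        ℓ+1+l≤ℓ′ : ℓ + suc l ≤ ℓ′
        ℓ+1+l≤ℓ′ = subst (_≤ ℓ′) (sym (+-suc ℓ l))
          (≰⇒> (λ ℓ′≤ℓ+l → c′≮μℓ′ (<-≤-trans (leg-top P c′<μℓ) (antitone ℓ′≤ℓ+l))))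

      balanced⇒initial : Initial μ
      balanced⇒initial {ℓ} {c} {ℓ′} {c′} c<μℓ c′≮μℓ′ with ℓ′ ≤? ℓ | c ≤? c′
      ... | yes ℓ′≤ℓ | _      = inj₁ (outside-below-heavier c<μℓ c′≮μℓ′ ℓ′≤ℓ)
      ... | no  ℓ′≰ℓ | yes c≤c′ = inj₁ (weight-mono-<-≤ (≰⇒> ℓ′≰ℓ) c≤c′)
      ... | no  _    | no  c≰c′ = weight≤⇒≺ (outside-left-not-lighter c<μℓ c′≮μℓ′ (<⇒≤ (≰⇒> c≰c′))) (≰⇒> c≰c′)

  initial-⊆ : ∀ α μ → Initial α → Initial μ → ∀ {i} → row μ i < row α i → μ ⊆ₚ α
  initial-⊆ α μ Iα Iμ {i} μᵢ<αᵢ ℓ = ≮⇒≥ (λ αℓ<μℓ → ≺-asym (Iα μᵢ<αᵢ (n≮n _)) (Iμ αℓ<μℓ (n≮n _)))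

  initial-nested : ∀ α μ → Initial α → Initial μ → size α ≤ size μ → α ⊆ₚ μ
  initial-nested α μ Iα Iμ |α|≤|μ| i = ≮⇒≥ (λ μᵢ<αᵢ →
    <⇒≱ (size-mono-< μ α (initial-⊆ α μ Iα Iμ μᵢ<αᵢ) i μᵢ<αᵢ) |α|≤|μ|)

  initial-unique : ∀ α μ → IsPartition α → IsPartition μ → Initial α → Initial μ → size α ≡ size μ → α ≡ μ
  initial-unique α μ Pα Pμ Iα Iμ |α|≡|μ| = row-injective (proj₂ Pα) (proj₂ Pμ) (λ i →
    ≤-antisym (initial-nested α μ Iα Iμ (≤-reflexive |α|≡|μ|) i) (initial-nested μ α Iμ Iα (≤-reflexive (sym |α|≡|μ|)) i))

  lastCell : List ℕ → ℕ → ℕ × ℕ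
  lastCell μ ℓ = ℓ , pred (row μ ℓ)

  lastCell-maximum : ∀ μ n → Σ[ k ∈ ℕ ] k ≤ n × (∀ {ℓ} → ℓ ≤ n → ℓ ≢ k → lastCell μ ℓ ≺ lastCell μ k)
  lastCell-maximum μ zero = 0 , z≤n , λ { z≤n 0≢0 → contradiction refl 0≢0 }
  lastCell-maximum μ (suc n) with lastCell-maximum μ n
  ... | k , k≤n , k-max with ≺-total {lastCell μ k} {lastCell μ (suc n)} (<⇒≢ (s≤s k≤n))
  ...   | inj₁ k≺n+1 = suc n , ≤-refl , n+1-max
    where
    n+1-max : ∀ {ℓ} → ℓ ≤ suc n → ℓ ≢ suc n → lastCell μ ℓ ≺ lastCell μ (suc n)
    n+1-max {ℓ} ℓ≤n+1 ℓ≢n+1 with ℓ ≟ k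
    ... | yes refl = k≺n+1
    ... | no  ℓ≢k  = ≺-trans (k-max (s≤s⁻¹ (≤∧≢⇒< ℓ≤n+1 ℓ≢n+1)) ℓ≢k) k≺n+1
  ...   | inj₂ n+1≺k = k , m≤n⇒m≤1+n k≤n , k-max′
    where
    k-max′ : ∀ {ℓ} → ℓ ≤ suc n → ℓ ≢ k → lastCell μ ℓ ≺ lastCell μ k
    k-max′ {ℓ} ℓ≤n+1 ℓ≢k with ℓ ≟ suc n
    ... | yes refl  = n+1≺k
    ... | no ℓ≢n+1 = k-max (s≤s⁻¹ (≤∧≢⇒< ℓ≤n+1 ℓ≢n+1)) ℓ≢k

  initial-removeLast : ∀ {μ k} (P : IsPartition μ) (corner : Corner μ k) → Initial μ →
    (∀ {ℓ c} → c < row μ ℓ → ℓ ≢ k → (ℓ , c) ≺ lastCell μ k) → Initial (removeLast μ k)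
  initial-removeLast {μ} {k} P corner I k-max {ℓ} {c} {ℓ′} {c′} c<μ′ℓ c′≮μ′ℓ′ with c′ <? row μ ℓ′
  ... | no c′≮μℓ′ = I (<-≤-trans c<μ′ℓ (removeLast-⊆ P corner ℓ)) c′≮μℓ′
  ... | yes c′<μℓ′ with removeLast-removed P corner c′<μℓ′ c′≮μ′ℓ′
  ...   | refl , refl with ℓ ≟ k
  ...     | no ℓ≢k   = k-max (<-≤-trans c<μ′ℓ (removeLast-⊆ P corner ℓ)) ℓ≢k
  ...     | yes refl = inj₁ (weight-mono-≤-< ≤-refl (subst (c <_) (row-removeLast-≡ μ k (proj₂ P) corner) c<μ′ℓ))

  initial-shrink : ∀ {μ} → IsPartition μ → Initial μ → 0 < size μ →
    Σ[ μ′ ∈ List ℕ ] IsPartition μ′ × μ′ ⊆ₚ μ × Initial μ′ × suc (size μ′) ≡ size μ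
  initial-shrink {[]}         _ _ ()
  initial-shrink {μ@(x ∷ xs)} P I _ =
    removeLast μ k , removeLast-isPartition P corner , removeLast-⊆ P corner ,
    initial-removeLast P corner I below-k , size-removeLast μ k μₖ>0
    where
    max = lastCell-maximum μ (length xs)
    k = proj₁ max
    μₖ>0 : 0 < row μ k
    μₖ>0 = <length⇒row>0 (proj₂ P) (s≤s (proj₁ (proj₂ max)))
    below-k : ∀ {ℓ c} → c < row μ ℓ → ℓ ≢ k → (ℓ , c) ≺ lastCell μ k
    below-k c<μℓ ℓ≢k = ≺-leftward (<⇒≤pred c<μℓ)
      (proj₂ (proj₂ max) (s≤s⁻¹ (row>0⇒<length μ (≤-<-trans z≤n c<μℓ))) ℓ≢k)
    -- If row k + 1 were as long as row k, the cell above lastCell μ k would lie in μ and be ≺-larger.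
    corner : Corner μ k
    corner = ≰⇒> (λ μₖ≤μₖ₊₁ → ≺-asym
      (below-k (subst (_≤ row μ (suc k)) (sym (suc-pred _ {{>-nonZero μₖ>0}})) μₖ≤μₖ₊₁) 1+n≢n)
      (inj₁ (weight-mono-<-≤ (n<1+n k) ≤-refl)))

  initial-of-size : ∀ {la} → IsPartition la → Initial la → ∀ j → j ≤ size la →
    Σ[ μ ∈ List ℕ ] IsPartition μ × μ ⊆ₚ la × Initial μ × size μ + j ≡ size la
  initial-of-size {la} P I zero    _ = la , P , (λ _ → ≤-refl) , I , +-identityʳ (size la)
  initial-of-size {la} P I (suc j) j<|la| with initial-of-size P I j (<⇒≤ j<|la|)
  ... | μ , Pμ , μ⊆la , Iμ , |μ|+j≡|la|
    with initial-shrink Pμ Iμ (+-cancelʳ-< j 0 (size μ) (subst (j <_) (sym |μ|+j≡|la|) j<|la|))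
  ...   | μ′ , Pμ′ , μ′⊆μ , Iμ′ , |μ′|+1≡|μ| =
    μ′ , Pμ′ , (λ i → ≤-trans (μ′⊆μ i) (μ⊆la i)) , Iμ′ ,
    trans (+-suc (size μ′) j) (trans (cong (_+ j) |μ′|+1≡|μ|) |μ|+j≡|la|)

  initial-of-area : ∀ {la} → IsPartition la → Initial la → ∀ k → k ≤ size la →
    Σ[ μ ∈ List ℕ ] (IsPartition μ × μ ⊆ₚ la × Initial μ × area la μ ≡ k)
                  × (∀ ν → IsPartition ν → ν ⊆ₚ la → Initial ν → area la ν ≡ k → ν ≡ μ)
  initial-of-area {la} P I k k≤|la| =
    let μ , Pμ , μ⊆la , Iμ , |μ|+k≡|la| = initial-of-size P I k k≤|la| in
    μ , (Pμ , μ⊆la , Iμ , +≡⇒area≡ la μ |μ|+k≡|la|) ,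
    λ ν Pν ν⊆la Iν area≡k → initial-unique ν μ Pν Pμ Iν Iμ
      (+-cancelʳ-≡ k _ _ (trans (area≡⇒+≡ la ν ν⊆la area≡k) (sym |μ|+k≡|la|)))

-- Rational arithmetic

-- ℚ stores (+ a) / suc b in lowest terms; in ℚᵘ it is literally a / (1 + b), so compare there.

private
  toℚᵘ-/ : ∀ a b → ℚ.toℚᵘ ((+ a) / suc b) ℚᵘ.≃ mkℚᵘ (+ a) b
  toℚᵘ-/ a b = ℚₚ.toℚᵘ-fromℚᵘ (mkℚᵘ (+ a) b)

module _ (a b c e : ℕ) where

  /-<⇒*-< : (+ a) / suc b ℚ.< (+ c) / suc e → a * suc e < c * suc b
  /-<⇒*-< a/b<c/e = ℤₚ.drop‿+<+ (subst₂ ℤ._<_ (sym (ℤₚ.pos-* a (suc e))) (sym (ℤₚ.pos-* c (suc b)))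
    (ℚᵘₚ.drop-*<* (ℚᵘₚ.<-respˡ-≃ (toℚᵘ-/ a b) (ℚᵘₚ.<-respʳ-≃ (toℚᵘ-/ c e) (ℚₚ.toℚᵘ-mono-< a/b<c/e)))))

  *-<⇒/-< : a * suc e < c * suc b → (+ a) / suc b ℚ.< (+ c) / suc e
  *-<⇒/-< ae<cb = ℚₚ.toℚᵘ-cancel-< (ℚᵘₚ.<-respˡ-≃ (ℚᵘₚ.≃-sym (toℚᵘ-/ a b)) (ℚᵘₚ.<-respʳ-≃ (ℚᵘₚ.≃-sym (toℚᵘ-/ c e))
    (*<* (subst₂ ℤ._<_ (ℤₚ.pos-* a (suc e)) (ℤₚ.pos-* c (suc b)) (ℤ.+<+ ae<cb)))))

  /-≤⇒*-≤ : (+ a) / suc b ℚ.≤ (+ c) / suc e → a * suc e ≤ c * suc b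
  /-≤⇒*-≤ a/b≤c/e = ℤₚ.drop‿+≤+ (subst₂ ℤ._≤_ (sym (ℤₚ.pos-* a (suc e))) (sym (ℤₚ.pos-* c (suc b)))
    (ℚᵘₚ.drop-*≤* (ℚᵘₚ.≤-respˡ-≃ (toℚᵘ-/ a b) (ℚᵘₚ.≤-respʳ-≃ (toℚᵘ-/ c e) (ℚₚ.toℚᵘ-mono-≤ a/b≤c/e)))))

  *-≤⇒/-≤ : a * suc e ≤ c * suc b → (+ a) / suc b ℚ.≤ (+ c) / suc e
  *-≤⇒/-≤ ae≤cb = ℚₚ.toℚᵘ-cancel-≤ (ℚᵘₚ.≤-respˡ-≃ (ℚᵘₚ.≃-sym (toℚᵘ-/ a b)) (ℚᵘₚ.≤-respʳ-≃ (ℚᵘₚ.≃-sym (toℚᵘ-/ c e))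
    (*≤* (subst₂ ℤ._≤_ (ℤₚ.pos-* a (suc e)) (ℤₚ.pos-* c (suc b)) (ℤ.+≤+ ae≤cb)))))

nℚ-mono-< : ∀ {m n} → m < n → nℚ m ℚ.< nℚ n
nℚ-mono-< {m} {n} m<n = *-<⇒/-< m 0 n 0 (*-monoˡ-< 1 m<n)

nℚ-cancel-< : ∀ {m n} → nℚ m ℚ.< nℚ n → m < n
nℚ-cancel-< {m} {n} m<n = subst₂ _<_ (*-identityʳ m) (*-identityʳ n) (/-<⇒*-< m 0 n 0 m<n)

nℚ-mono-≤ : ∀ {m n} → m ≤ n → nℚ m ℚ.≤ nℚ n
nℚ-mono-≤ {m} {n} m≤n = *-≤⇒/-≤ m 0 n 0 (*-monoˡ-≤ 1 m≤n)

nℚ≡mkℚ : ∀ n → nℚ n ≡ mkℚ (+ n) 0 (Coprime-sym (1-coprimeTo n))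
nℚ≡mkℚ n = ℚₚ.normalize-coprime (Coprime-sym (1-coprimeTo n))

nℚ-+ : ∀ m n → nℚ (m + n) ≡ nℚ m ℚ.+ nℚ n
nℚ-+ m n rewrite nℚ≡mkℚ m | nℚ≡mkℚ n | ℤₚ.*-identityʳ (+ m) | ℤₚ.*-identityʳ (+ n) =
  cong (_/ 1) (ℤₚ.pos-+ m n)

nℚ-* : ∀ m n → nℚ (m * n) ≡ nℚ m ℚ.* nℚ n
nℚ-* m n rewrite nℚ≡mkℚ m | nℚ≡mkℚ n = cong (_/ 1) (ℤₚ.pos-* m n)

n≤⌊q⌋⇒n≤q : ∀ n q → + n ℤ.≤ ℚ.floor q → nℚ n ℚ.≤ q
n≤⌊q⌋⇒n≤q n (mkℚ a m _) n≤⌊q⌋ rewrite nℚ≡mkℚ n = ℚ.*≤* (begin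
  + n ℤ.* + suc m          ≤⟨ ℤₚ.*-monoʳ-≤-nonNeg (+ suc m) n≤⌊q⌋ ⟩
  a ℤ./ + suc m ℤ.* + suc m ≤⟨ [n/d]*d≤n a (+ suc m) ⟩
  a                         ≡⟨ ℤₚ.*-identityʳ a ⟨
  a ℤ.* + 1                 ∎)
  where open ℤₚ.≤-Reasoning

n≤q⇒n≤⌊q⌋ : ∀ n q → nℚ n ℚ.≤ q → + n ℤ.≤ ℚ.floor q
n≤q⇒n≤⌊q⌋ n (mkℚ a m _) n≤q rewrite nℚ≡mkℚ n = ℤₚ.≮⇒≥ (λ ⌊q⌋<n → ℤₚ.<-irrefl refl (begin-strict
  ℤ.suc (a ℤ./ + suc m) ℤ.* + suc m ≤⟨ ℤₚ.*-monoʳ-≤-nonNeg (+ suc m) (ℤₚ.i<j⇒suc[i]≤j ⌊q⌋<n) ⟩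
  + n ℤ.* + suc m                   ≤⟨ subst (+ n ℤ.* + suc m ℤ.≤_) (ℤₚ.*-identityʳ a) (ℚₚ.drop-*≤* n≤q) ⟩
  a                                 <⟨ n<s[n/ℕd]*d a (suc m) ⟩
  ℤ.suc (a ℤ./ℕ suc m) ℤ.* + suc m  ≡⟨ cong (λ ⌊q⌋ → ℤ.suc ⌊q⌋ ℤ.* + suc m) (div-pos-is-/ℕ a (suc m)) ⟨
  ℤ.suc (a ℤ./ + suc m) ℤ.* + suc m ∎))
  where open ℤₚ.≤-Reasoning

p≤q-r⇒p+r≤q : ∀ {p q r} → p ℚ.≤ q ℚ.- r → p ℚ.+ r ℚ.≤ q
p≤q-r⇒p+r≤q {p} {q} {r} p≤q-r = subst (p ℚ.+ r ℚ.≤_) (cancel q r) (ℚₚ.+-monoˡ-≤ r p≤q-r)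
  where
  cancel : ∀ q r → q ℚ.- r ℚ.+ r ≡ q
  cancel = solve 2 (λ q r → q :- r :+ r := q) refl
    where open ℚSolver

p+r≤q⇒p≤q-r : ∀ {p q r} → p ℚ.+ r ℚ.≤ q → p ℚ.≤ q ℚ.- r
p+r≤q⇒p≤q-r {p} {q} {r} p+r≤q = subst (ℚ._≤ q ℚ.- r) (cancel p r) (ℚₚ.+-monoˡ-≤ (ℚ.- r) p+r≤q)
  where
  cancel : ∀ p r → p ℚ.+ r ℚ.- r ≡ p
  cancel = solve 2 (λ p r → p :+ r :- r := p) refl
    where open ℚSolver

p+q<p+r⇒q<r : ∀ p {q r} → p ℚ.+ q ℚ.< p ℚ.+ r → q ℚ.< r
p+q<p+r⇒q<r p {q} {r} p+q<p+r = subst₂ ℚ._<_ (cancel p q) (cancel p r) (ℚₚ.+-monoˡ-< (ℚ.- p) p+q<p+r)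
  where
  cancel : ∀ p q → p ℚ.+ q ℚ.- p ≡ q
  cancel = solve 2 (λ p q → p :+ q :- p := q) refl
    where open ℚSolver

private
  double-half : ∀ a → (a ℚ.+ a) ℚ.÷ nℚ 2 ≡ a
  double-half a = begin
    (a ℚ.+ a) ℚ.* ½            ≡⟨ ℚₚ.*-distribʳ-+ ½ a a ⟩
    a ℚ.* ½ ℚ.+ a ℚ.* ½        ≡⟨ ℚₚ.*-distribˡ-+ a ½ ½ ⟨
    a ℚ.* (½ ℚ.+ ½)            ≡⟨⟩
    a ℚ.* 1ℚ                   ≡⟨ ℚₚ.*-identityʳ a ⟩
    a                          ∎
    where
    open ≡-Reasoning
    ½ = ℚ.1/ nℚ 2

<-midpoint : ∀ {a b} → a ℚ.< b → a ℚ.< (a ℚ.+ b) ℚ.÷ nℚ 2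
<-midpoint {a} {b} a<b =
  subst (ℚ._< (a ℚ.+ b) ℚ.÷ nℚ 2) (double-half a) (ℚₚ.*-monoˡ-<-pos (ℚ.1/ nℚ 2) (ℚₚ.+-monoʳ-< a a<b))

midpoint-< : ∀ {a b} → a ℚ.< b → (a ℚ.+ b) ℚ.÷ nℚ 2 ℚ.< b
midpoint-< {a} {b} a<b =
  subst ((a ℚ.+ b) ℚ.÷ nℚ 2 ℚ.<_) (double-half b) (ℚₚ.*-monoˡ-<-pos (ℚ.1/ nℚ 2) (ℚₚ.+-monoˡ-< b a<b))

proper-fraction : ∀ q → 0ℚ ℚ.< q → q ℚ.< 1ℚ →
                  Σ[ p ∈ ℕ ] Σ[ D ∈ ℕ ] q ≡ (+ p) / suc D × 0 < p × p < suc D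
proper-fraction q@(mkℚ (+ p) D _) 0<q q<1 = p , D , sym q≡p/1+D ,
  subst (0 <_) (*-identityʳ p) (/-<⇒*-< 0 0 p D (subst (0ℚ ℚ.<_) (sym q≡p/1+D) 0<q)) ,
  subst₂ _<_ (*-identityʳ p) (*-identityˡ (suc D)) (/-<⇒*-< p D 1 0 (subst (ℚ._< 1ℚ) (sym q≡p/1+D) q<1))
  where q≡p/1+D = ℚₚ.↥p/↧p≡p q
proper-fraction (mkℚ -[1+ _ ] _ _) 0<q _ with ℚₚ.drop-*<* 0<q
... | ()

maxℚ≡⊔ : ∀ p q → maxℚ p q ≡ p ℚ.⊔ q
maxℚ≡⊔ record{} record{} = refl

minℚ≡⊓ : ∀ p q → minℚ p q ≡ p ℚ.⊓ q
minℚ≡⊓ record{} record{} = refl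

maxℚ-< : ∀ {p q r} → p ℚ.< r → q ℚ.< r → maxℚ p q ℚ.< r
maxℚ-< {p} {q} p<r q<r with p ℚ.≤ᵇ q
... | true  = q<r
... | false = p<r

<-minℚ : ∀ {p q r} → r ℚ.< p → r ℚ.< q → r ℚ.< minℚ p q
<-minℚ {p} {q} r<p r<q with p ℚ.≤ᵇ q
... | true  = r<p
... | false = r<q

module _ {A : Set} (f : A → ℚ) where

  foldMax foldMin : ℚ → List A → ℚ
  foldMax z = foldr (λ x → maxℚ (f x)) z
  foldMin z = foldr (λ x → minℚ (f x)) z

  init≤foldMax : ∀ z xs → z ℚ.≤ foldMax z xs
  init≤foldMax z []       = ℚₚ.≤-refl
  init≤foldMax z (x ∷ xs) rewrite maxℚ≡⊔ (f x) (foldMax z xs) = ℚₚ.p≤q⇒p≤r⊔q (f x) (init≤foldMax z xs)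

  ∈⇒≤foldMax : ∀ z {x xs} → x ∈ xs → f x ℚ.≤ foldMax z xs
  ∈⇒≤foldMax z {xs = y ∷ xs} (here refl) rewrite maxℚ≡⊔ (f y) (foldMax z xs) = ℚₚ.p≤p⊔q (f y) _
  ∈⇒≤foldMax z {xs = y ∷ xs} (there x∈xs) rewrite maxℚ≡⊔ (f y) (foldMax z xs) =
    ℚₚ.p≤q⇒p≤r⊔q (f y) (∈⇒≤foldMax z x∈xs)

  foldMax-< : ∀ {z r} xs → z ℚ.< r → All (λ x → f x ℚ.< r) xs → foldMax z xs ℚ.< r
  foldMax-< []       z<r []            = z<r
  foldMax-< (x ∷ xs) z<r (fx<r ∷ fxs<r) = maxℚ-< fx<r (foldMax-< xs z<r fxs<r)

  foldMin≤init : ∀ z xs → foldMin z xs ℚ.≤ z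
  foldMin≤init z []       = ℚₚ.≤-refl
  foldMin≤init z (x ∷ xs) rewrite minℚ≡⊓ (f x) (foldMin z xs) = ℚₚ.p≤q⇒r⊓p≤q (f x) (foldMin≤init z xs)

  ∈⇒foldMin≤ : ∀ z {x xs} → x ∈ xs → foldMin z xs ℚ.≤ f x
  ∈⇒foldMin≤ z {xs = y ∷ xs} (here refl) rewrite minℚ≡⊓ (f y) (foldMin z xs) = ℚₚ.p⊓q≤p (f y) _
  ∈⇒foldMin≤ z {xs = y ∷ xs} (there x∈xs) rewrite minℚ≡⊓ (f y) (foldMin z xs) =
    ℚₚ.p≤q⇒r⊓p≤q (f y) (∈⇒foldMin≤ z x∈xs)

  <-foldMin : ∀ {z r} xs → r ℚ.< z → All (λ x → r ℚ.< f x) xs → r ℚ.< foldMin z xs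
  <-foldMin []       r<z []            = r<z
  <-foldMin (x ∷ xs) r<z (r<fx ∷ r<fxs) = <-minℚ r<fx (<-foldMin xs r<z r<fxs)

-- Hook slopes and the mean slope

vplus>0 : ∀ μ ℓ c → 0ℚ ℚ.< vplus μ ℓ c
vplus>0 μ ℓ c = *-<⇒/-< 0 0 (suc (leg μ ℓ c)) (arm μ ℓ c + leg μ ℓ c) z<s

vminus<1 : ∀ μ ℓ c → vminus μ ℓ c ℚ.< 1ℚ
vminus<1 μ ℓ c = *-<⇒/-< (leg μ ℓ c) (arm μ ℓ c + leg μ ℓ c) 1 0
  (subst₂ _<_ (sym (*-identityʳ _)) (sym (*-identityˡ _)) (s≤s (m≤n+m (leg μ ℓ c) (arm μ ℓ c))))

cross-separation : ∀ a₁ l₁ a₂ l₂ → a₂ * l₁ < suc a₁ * suc l₂ →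
                   (+ l₁) / suc (a₁ + l₁) ℚ.< (+ suc l₂) / suc (a₂ + l₂)
cross-separation a₁ l₁ a₂ l₂ a₂l₁<[1+a₁][1+l₂] = *-<⇒/-< l₁ (a₁ + l₁) (suc l₂) (a₂ + l₂)
  (subst₂ _<_ (sym (split₁ a₂ l₁ l₂)) (sym (split₂ a₁ l₁ l₂)) (+-monoˡ-< (l₁ * suc l₂) a₂l₁<[1+a₁][1+l₂]))
  where
  split₁ : ∀ a₂ l₁ l₂ → l₁ * suc (a₂ + l₂) ≡ a₂ * l₁ + l₁ * suc l₂
  split₁ = solve-∀
  split₂ : ∀ a₁ l₁ l₂ → suc l₂ * suc (a₁ + l₁) ≡ suc a₁ * suc l₂ + l₁ * suc l₂
  split₂ = solve-∀

slope-separation : ∀ σ a₁ l₁ a₂ l₂ → nℚ l₁ ℚ.* σ ℚ.< nℚ (suc a₁) → nℚ a₂ ℚ.< nℚ (suc l₂) ℚ.* σ →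
                   (+ l₁) / suc (a₁ + l₁) ℚ.< (+ suc l₂) / suc (a₂ + l₂)
slope-separation σ a₁ l₁ a₂ l₂ l₁σ<1+a₁ a₂<[1+l₂]σ = cross-separation a₁ l₁ a₂ l₂ (nℚ-cancel-< (begin-strict
  nℚ (a₂ * l₁)                     ≡⟨ nℚ-* a₂ l₁ ⟩
  nℚ a₂ ℚ.* nℚ l₁                  ≤⟨ ℚₚ.*-monoʳ-≤-nonNeg (nℚ l₁) (ℚₚ.<⇒≤ a₂<[1+l₂]σ) ⟩
  nℚ (suc l₂) ℚ.* σ ℚ.* nℚ l₁      ≡⟨ swap (nℚ (suc l₂)) σ (nℚ l₁) ⟩
  nℚ l₁ ℚ.* σ ℚ.* nℚ (suc l₂)      <⟨ ℚₚ.*-monoˡ-<-pos (nℚ (suc l₂)) l₁σ<1+a₁ ⟩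
  nℚ (suc a₁) ℚ.* nℚ (suc l₂)      ≡⟨ nℚ-* (suc a₁) (suc l₂) ⟨
  nℚ (suc a₁ * suc l₂)             ∎))
  where
  open ℚₚ.≤-Reasoning
  instance
    l₁≥0 : ℚ.NonNegative (nℚ l₁)
    l₁≥0 = ℚ.nonNegative (nℚ-mono-≤ {0} {l₁} z≤n)
    1+l₂>0 : ℚ.Positive (nℚ (suc l₂))
    1+l₂>0 = ℚ.positive (nℚ-mono-< {0} {suc l₂} z<s)
  swap : ∀ x y z → x ℚ.* y ℚ.* z ≡ z ℚ.* y ℚ.* x
  swap = solve 3 (λ x y z → x :* y :* z := z :* y :* x) refl
    where open ℚSolver

module _ {p D : ℕ} (p<1+D : p < suc D) where

  private
    d = suc D ∸ p
    1+D≡p+d : suc D ≡ p + d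
    1+D≡p+d = sym (m+[n∸m]≡n (<⇒≤ p<1+D))

    split-l*[p+d] : ∀ l p d → l * (p + d) ≡ l * p + d * l
    split-l*[p+d] = solve-∀
    split-p*[1+a+l] : ∀ p a l → p * suc (a + l) ≡ l * p + p * suc a
    split-p*[1+a+l] = solve-∀
    split-p*[1+a+l]′ : ∀ p a l → p * suc (a + l) ≡ p * suc l + p * a
    split-p*[1+a+l]′ = solve-∀
    split-[1+l]*[p+d] : ∀ l p d → suc l * (p + d) ≡ p * suc l + d * suc l
    split-[1+l]*[p+d] = solve-∀

    l*[1+D] : ∀ l → l * suc D ≡ l * p + d * l
    l*[1+D] l = trans (cong (l *_) 1+D≡p+d) (split-l*[p+d] l p d)

    [1+l]*[1+D] : ∀ l → suc l * suc D ≡ p * suc l + d * suc l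
    [1+l]*[1+D] l = trans (cong (suc l *_) 1+D≡p+d) (split-[1+l]*[p+d] l p d)

    <-ratio⇒ : ∀ l a → (+ l) / suc (a + l) ℚ.< (+ p) / suc D → d * l < p * suc a
    <-ratio⇒ l a v<q = +-cancelˡ-< (l * p) _ _
      (subst₂ _<_ (l*[1+D] l) (split-p*[1+a+l] p a l) (/-<⇒*-< l (a + l) p D v<q))

    ⇒<-ratio : ∀ l a → d * l < p * suc a → (+ l) / suc (a + l) ℚ.< (+ p) / suc D
    ⇒<-ratio l a dl<p[1+a] = *-<⇒/-< l (a + l) p D
      (subst₂ _<_ (sym (l*[1+D] l)) (sym (split-p*[1+a+l] p a l)) (+-monoʳ-< (l * p) dl<p[1+a]))

    ratio-≤⇒ : ∀ l a → (+ p) / suc D ℚ.≤ (+ suc l) / suc (a + l) → p * a ≤ d * suc l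
    ratio-≤⇒ l a q≤v = +-cancelˡ-≤ (p * suc l) _ _
      (subst₂ _≤_ (split-p*[1+a+l]′ p a l) ([1+l]*[1+D] l) (/-≤⇒*-≤ p D (suc l) (a + l) q≤v))

    ⇒ratio-≤ : ∀ l a → p * a ≤ d * suc l → (+ p) / suc D ℚ.≤ (+ suc l) / suc (a + l)
    ⇒ratio-≤ l a pa≤d[1+l] = *-≤⇒/-≤ p D (suc l) (a + l)
      (subst₂ _≤_ (sym (split-p*[1+a+l]′ p a l)) (sym ([1+l]*[1+D] l)) (+-monoʳ-≤ (p * suc l) pa≤d[1+l]))

  module _ {la} (mean≡ : meanSlope la ≡ (+ p) / suc D) where

    meanSimilar⇒balanced : ∀ {μ} → MeanSimilar la μ → Balanced p (suc D ∸ p) μ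
    meanSimilar⇒balanced {μ} sim ℓ c c<μℓ =
      <-ratio⇒ (leg μ ℓ c) (arm μ ℓ c) (subst (vminus μ ℓ c ℚ.<_) mean≡ (proj₁ (sim ℓ c c<μℓ))) ,
      ratio-≤⇒ (leg μ ℓ c) (arm μ ℓ c) (subst (ℚ._≤ vplus μ ℓ c) mean≡ (proj₂ (sim ℓ c c<μℓ)))

    balanced⇒meanSimilar : ∀ {μ} → Balanced p (suc D ∸ p) μ → MeanSimilar la μ
    balanced⇒meanSimilar {μ} bal ℓ c c<μℓ =
      subst (vminus μ ℓ c ℚ.<_) (sym mean≡) (⇒<-ratio (leg μ ℓ c) (arm μ ℓ c) (proj₁ (bal ℓ c c<μℓ))) ,
      subst (ℚ._≤ vplus μ ℓ c) (sym mean≡) (⇒ratio-≤ (leg μ ℓ c) (arm μ ℓ c) (proj₂ (bal ℓ c c<μℓ)))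

module MeanSlope {la : List ℕ}
  (v⁻<v⁺ : ∀ {ℓ c ℓ′ c′} → c < row la ℓ → c′ < row la ℓ′ → vminus la ℓ c ℚ.< vplus la ℓ′ c′) where

  private
    v⁻ v⁺ : ℕ × ℕ → ℚ
    v⁻ x = vminus la (proj₁ x) (proj₂ x)
    v⁺ x = vplus la (proj₁ x) (proj₂ x)

    cell-bound : ∀ {Q : ℕ × ℕ → Set} → (∀ {ℓ c} → c < row la ℓ → Q (ℓ , c)) → All Q (cells la)
    cell-bound Q-cell = All.map Q-cell (cells-below la)

    v⁻<vplusMin : ∀ {ℓ c} → c < row la ℓ → vminus la ℓ c ℚ.< vplusMin la
    v⁻<vplusMin {ℓ} {c} c<laℓ = <-foldMin v⁺ (cells la) (vminus<1 la ℓ c) (cell-bound (v⁻<v⁺ c<laℓ))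

  vminusMax<vplusMin : vminusMax la ℚ.< vplusMin la
  vminusMax<vplusMin = foldMax-< v⁻ (cells la)
    (<-foldMin v⁺ (cells la) (nℚ-mono-< {0} {1} z<s) (cell-bound (λ {ℓ} {c} _ → vplus>0 la ℓ c)))
    (cell-bound v⁻<vplusMin)

  meanSimilar-self : MeanSimilar la la
  meanSimilar-self ℓ c c<laℓ =
    ℚₚ.≤-<-trans (∈⇒≤foldMax v⁻ 0ℚ (∈-cells la c<laℓ)) (<-midpoint vminusMax<vplusMin) ,
    ℚₚ.<⇒≤ (ℚₚ.<-≤-trans (midpoint-< vminusMax<vplusMin) (∈⇒foldMin≤ v⁺ 1ℚ (∈-cells la c<laℓ)))

  meanSlope-fraction : Σ[ p ∈ ℕ ] Σ[ D ∈ ℕ ] meanSlope la ≡ (+ p) / suc D × 0 < p × p < suc D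
  meanSlope-fraction = proper-fraction (meanSlope la)
    (ℚₚ.≤-<-trans (init≤foldMax v⁻ 0ℚ (cells la)) (<-midpoint vminusMax<vplusMin))
    (ℚₚ.<-≤-trans (midpoint-< vminusMax<vplusMin) (foldMin≤init v⁺ 1ℚ (cells la)))

-- Triangular partitions

module TriangularShape {la : List ℕ} (P : IsPartition la) (r s : ℚ) (r>0 : ℚ.Positive r) (s>0 : ℚ.Positive s)
  (shape : ∀ j → 1 ≤ j → (nℚ j ℚ.≤ s → + row la (j ∸ 1) ≡ ℚ.floor (triVal r s s>0 j))
                         × (s ℚ.< nℚ j → row la (j ∸ 1) ≡ 0)) where

  private instance
    s≢0 : ℚ.NonZero s
    s≢0 = ℚₚ.pos⇒nonZero s {{s>0}}

  σ : ℚ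
  σ = r ℚ.* ℚ.1/ s

  -- λ_{ℓ+1} = ⌊r − (ℓ+1)σ⌋, so the cell (ℓ, c) lies in λ exactly when height (ℓ+1) (c+1) ≤ r.
  height : ℕ → ℕ → ℚ
  height ℓ c = nℚ c ℚ.+ nℚ ℓ ℚ.* σ

  private
    instance
      σ>0 : ℚ.Positive σ
      σ>0 = ℚₚ.pos*pos⇒pos r {{r>0}} (ℚ.1/ s) {{ℚₚ.1/pos⇒pos s {{s>0}}}}

    triVal≡ : ∀ j → triVal r s s>0 j ≡ r ℚ.- nℚ j ℚ.* σ
    triVal≡ j = cong (ℚ._-_ r) (ℚₚ.*-assoc (nℚ j) r (ℚ.1/ s))

    s*σ≡r : s ℚ.* σ ≡ r
    s*σ≡r = trans (rearrange s r (ℚ.1/ s)) (trans (cong (r ℚ.*_) (ℚₚ.*-inverseʳ s)) (ℚₚ.*-identityʳ r))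
      where
      rearrange : ∀ s r i → s ℚ.* (r ℚ.* i) ≡ r ℚ.* (s ℚ.* i)
      rearrange = solve 3 (λ s r i → s :* (r :* i) := r :* (s :* i)) refl
        where open ℚSolver

  ∈⇒height≤r : ∀ {ℓ c} → c < row la ℓ → height (suc ℓ) (suc c) ℚ.≤ r
  ∈⇒height≤r {ℓ} {c} c<laℓ with nℚ (suc ℓ) ℚₚ.≤? s
  ... | yes 1+ℓ≤s = p≤q-r⇒p+r≤q (subst (nℚ (suc c) ℚ.≤_) (triVal≡ (suc ℓ))
          (n≤⌊q⌋⇒n≤q (suc c) _ (subst (+ suc c ℤ.≤_) (proj₁ (shape (suc ℓ) (s≤s z≤n)) 1+ℓ≤s) (ℤ.+≤+ c<laℓ))))
  ... | no 1+ℓ≰s = contradiction (subst (c <_) (proj₂ (shape (suc ℓ) (s≤s z≤n)) (ℚₚ.≰⇒> 1+ℓ≰s)) c<laℓ) n≮0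

  ∉⇒r<height : ∀ {ℓ c} → ¬ c < row la ℓ → r ℚ.< height (suc ℓ) (suc c)
  ∉⇒r<height {ℓ} {c} c≮laℓ with nℚ (suc ℓ) ℚₚ.≤? s
  ... | yes 1+ℓ≤s = ℚₚ.≰⇒> (λ height≤r → c≮laℓ (ℤₚ.drop‿+≤+
          (subst (+ suc c ℤ.≤_) (sym (proj₁ (shape (suc ℓ) (s≤s z≤n)) 1+ℓ≤s))
            (n≤q⇒n≤⌊q⌋ (suc c) _ (subst (nℚ (suc c) ℚ.≤_) (sym (triVal≡ (suc ℓ))) (p+r≤q⇒p≤q-r height≤r))))))
  ... | no 1+ℓ≰s = begin-strict
    r                           ≡⟨ s*σ≡r ⟨
    s ℚ.* σ                     <⟨ ℚₚ.*-monoˡ-<-pos σ (ℚₚ.≰⇒> 1+ℓ≰s) ⟩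
    nℚ (suc ℓ) ℚ.* σ            ≡⟨ ℚₚ.+-identityˡ _ ⟨
    0ℚ ℚ.+ nℚ (suc ℓ) ℚ.* σ     <⟨ ℚₚ.+-monoˡ-< (nℚ (suc ℓ) ℚ.* σ) (nℚ-mono-< {0} {suc c} z<s) ⟩
    height (suc ℓ) (suc c)      ∎
    where open ℚₚ.≤-Reasoning

  height-+ʳ : ∀ ℓ c a → height ℓ (c + a) ≡ height ℓ c ℚ.+ nℚ a
  height-+ʳ ℓ c a rewrite nℚ-+ c a = shift (nℚ c) (nℚ a) (nℚ ℓ ℚ.* σ)
    where
    shift : ∀ x y z → x ℚ.+ y ℚ.+ z ≡ x ℚ.+ z ℚ.+ y
    shift = solve 3 (λ x y z → x :+ y :+ z := x :+ z :+ y) refl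
      where open ℚSolver

  height-+ˡ : ∀ ℓ l c → height (ℓ + l) c ≡ height ℓ c ℚ.+ nℚ l ℚ.* σ
  height-+ˡ ℓ l c rewrite nℚ-+ ℓ l = shift (nℚ c) (nℚ ℓ) (nℚ l) σ
    where
    shift : ∀ x y z w → x ℚ.+ (y ℚ.+ z) ℚ.* w ≡ x ℚ.+ y ℚ.* w ℚ.+ z ℚ.* w
    shift = solve 4 (λ x y z w → x :+ (y :+ z) :* w := x :+ y :* w :+ z :* w) refl
      where open ℚSolver

  module _ {ℓ c} (c<laℓ : c < row la ℓ) where

    private
      a = arm la ℓ c
      l = leg la ℓ c
      base = height (suc ℓ) (suc c)
      row-end = row-arm la c<laℓ

    arm<[1+leg]σ : nℚ a ℚ.< nℚ (suc l) ℚ.* σ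
    arm<[1+leg]σ = p+q<p+r⇒q<r base (begin-strict
      base ℚ.+ nℚ a                      ≡⟨ height-+ʳ (suc ℓ) (suc c) a ⟨
      height (suc ℓ) (suc c + a)           ≤⟨ ∈⇒height≤r (subst (c + a <_) (sym row-end) (+-monoʳ-< c ≤-refl)) ⟩
      r                                    <⟨ ∉⇒r<height {ℓ + suc l} {c} (leg-out P) ⟩
      height (suc ℓ + suc l) (suc c)       ≡⟨ height-+ˡ (suc ℓ) (suc l) (suc c) ⟩
      base ℚ.+ nℚ (suc l) ℚ.* σ          ∎)
      where open ℚₚ.≤-Reasoning

    leg·σ<1+arm : nℚ l ℚ.* σ ℚ.< nℚ (suc a)
    leg·σ<1+arm = p+q<p+r⇒q<r base (begin-strict
      base ℚ.+ nℚ l ℚ.* σ                ≡⟨ height-+ˡ (suc ℓ) l (suc c) ⟨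
      height (suc ℓ + l) (suc c)           ≤⟨ ∈⇒height≤r (leg-top P c<laℓ) ⟩
      r                                    <⟨ ∉⇒r<height {ℓ} {c + suc a} (n≮n _ ∘ subst (c + suc a <_) row-end) ⟩
      height (suc ℓ) (suc c + suc a)       ≡⟨ height-+ʳ (suc ℓ) (suc c) (suc a) ⟩
      base ℚ.+ nℚ (suc a)                ∎)
      where open ℚₚ.≤-Reasoning

  vminus<vplus : ∀ {ℓ c ℓ′ c′} → c < row la ℓ → c′ < row la ℓ′ → vminus la ℓ c ℚ.< vplus la ℓ′ c′
  vminus<vplus {ℓ} {c} {ℓ′} {c′} c<laℓ c′<laℓ′ = slope-separation σ
    (arm la ℓ c) (leg la ℓ c) (arm la ℓ′ c′) (leg la ℓ′ c′) (leg·σ<1+arm c<laℓ) (arm<[1+leg]σ c′<laℓ′)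

proposition3p2 : (la : List ℕ) → IsPartition la → Triangular la →
    ((k : ℕ) → k ≤ size la →
      Σ (List ℕ) (λ μ →
        (IsPartition μ × μ ⊆ₚ la × MeanSimilar la μ × area la μ ≡ k)
        × ((ν : List ℕ) → IsPartition ν → ν ⊆ₚ la → MeanSimilar la ν → area la ν ≡ k → ν ≡ μ)))
    × ((α μ : List ℕ) → IsPartition α → IsPartition μ → α ⊆ₚ la → μ ⊆ₚ la →
        MeanSimilar la α → MeanSimilar la μ → size α ≤ size μ → α ⊆ₚ μ)
proposition3p2 la P (r , s , r>0 , s>0 , shape) =
  let open MeanSlope {la} (TriangularShape.vminus<vplus {la} P r s r>0 s>0 shape)
      p , D , mean≡ , p>0 , p<1+D = meanSlope-fraction
      open SlopeOrder p (suc D ∸ p) {{>-nonZero p>0}} {{>-nonZero (m<n⇒0<n∸m p<1+D)}}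
      initial : ∀ {μ} → IsPartition μ → MeanSimilar la μ → Initial μ
      initial {μ} Pμ = balanced⇒initial {μ} Pμ ∘ meanSimilar⇒balanced p<1+D {la} mean≡ {μ}
  in (λ k k≤|la| →
        let μ , (Pμ , μ⊆la , Iμ , area≡k) , unique = initial-of-area P (initial P meanSimilar-self) k k≤|la|
        in μ , (Pμ , μ⊆la , balanced⇒meanSimilar p<1+D {la} mean≡ {μ} (initial⇒balanced {μ} Pμ Iμ) , area≡k) ,
           λ ν Pν ν⊆la simν → unique ν Pν ν⊆la (initial Pν simν)) ,
     λ α μ Pα Pμ _ _ simα simμ → initial-nested α μ (initial Pα simα) (initial Pμ simμ)
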